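{- For every prime number $p$ and every $e\in\mathbb{N}$, the structure $(\mathbb{Z}/p^e\mathbb{Z};+,\neq_0)$ has a primitive positive interpretation in $(\mathbb{Z}_p;+,<^p_e)$.
   Context: $\mathbb{Z}_p=\{x\in\mathbb{Q}_p: v_p(x)\geq 0\}$ is the ring of $p$-adic integers, $v_p$ the $p$-adic valuation. $<^p_e$ denotes the unary relation $\{x: v_p(x)<e\}$, and $\neq_0$ the unary relation $(\mathbb{Z}/p^e\mathbb{Z})\setminus\{0\}$. A primitive positive formula is one of the form $\exists x_1\dots x_n(\psi_1\wedge\dots\wedge\psi_m)$ with $\psi_i$ atomic. A $d$-dimensional primitive positive interpretation of a structure $\mathfrak A$ (domain $A$) in a structure $\mathfrak B$ (domain $B$) is a partial surjective map $I$ from $B^d$ onto $A$ such that the preimages under $I$ of $A$, of the equality relation on $A$, of each relation of $\mathfrak A$, and of the graph of each function of $\mathfrak A$ are definable in $\mathfrak B$ by primitive positive formulas. -}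

module Defs where

open import Level using (0ℓ)
open import Data.Nat using (ℕ; zero; suc; _+_; _^_; _<_; NonZero)
open import Data.Nat.Properties using (m^n≢0)
open import Data.Nat.DivMod using (_%_; m%n<n; %-distribˡ-+; m∣n⇒o%n%m≡o%m)
open import Data.Nat.Divisibility using (n∣m*n)
open import Data.Fin using (Fin; toℕ; fromℕ<)
open import Data.List using (List)
open import Data.List.Relation.Unary.All using (All)
open import Data.Product using (Σ; ∃; _×_; _,_)
open import Data.Vec.Functional using (_++_)
open import Relation.Nullary using (¬_)
open import Relation.Binary.PropositionalEquality using (_≡_; cong₂; trans)
open import Function.Bundles using (_⇔_)

-- The p-adic integers ℤ_p, as the inverse limit  lim ℤ/p^n ℤ :
-- compatible sequences of residues  res n ∈ {0,…,p^n - 1}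
-- with  res (n+1) mod p^n = res n.

module _ (p : ℕ) .{{nzp : NonZero p}} where

  modp : ℕ → ℕ → ℕ
  modp n a = _%_ a (p ^ n) {{m^n≢0 p n}}

  record ℤp : Set where
    field
      res  : ℕ → ℕ
      res< : ∀ n → res n < p ^ n
      coh  : ∀ n → modp n (res (suc n)) ≡ res n
  open ℤp public

  _≈ₚ_ : ℤp → ℤp → Set
  x ≈ₚ y = ∀ n → res x n ≡ res y n

  private
    step : ∀ n (a b : ℕ) → modp n (modp (suc n) (a + b))
                         ≡ modp n (modp n a + modp n b)
    step n a b = trans (m∣n⇒o%n%m≡o%m (p ^ n) (p ^ suc n) (a + b)
                          {{m^n≢0 p n}} {{m^n≢0 p (suc n)}} (n∣m*n p))
                       (%-distribˡ-+ a b (p ^ n) {{m^n≢0 p n}})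

  _+ₚ_ : ℤp → ℤp → ℤp
  res (x +ₚ y) n = modp n (res x n + res y n)
  res< (x +ₚ y) n = m%n<n (res x n + res y n) (p ^ n) {{m^n≢0 p n}}
  coh (x +ₚ y) n = trans (step n (res x (suc n)) (res y (suc n)))
                         (cong₂ (λ a b → modp n (a + b)) (coh x n) (coh y n))

  -- The relation <^p_e = { x : v_p(x) < e }.
  -- v_p(x) ≥ e  iff  x ∈ p^e ℤ_p  iff  the image of x in ℤ/p^e ℤ is 0,
  -- hence v_p(x) < e iff res x e ≠ 0.
  vLt : ℕ → ℤp → Set
  vLt e x = ¬ (res x e ≡ 0)

data Term (n : ℕ) : Set where
  var : Fin n → Term n
  _⊕_ : Term n → Term n → Term n

data Atom (n : ℕ) : Set where
  _≐_ : Term n → Term n → Atom n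
  lt  : Term n → Atom n

-- A pp formula with k free variables: ∃ y₁…y_m (ψ₁ ∧ … ∧ ψ_l),
-- the atoms ψᵢ using the variables x₁…x_k,y₁…y_m (indexed by Fin (k + m)).
record PP (k : ℕ) : Set where
  constructor ppf
  field
    nex   : ℕ
    atoms : List (Atom (k + nex))

module _ (p : ℕ) .{{nzp : NonZero p}} (e : ℕ) where

  evalT : ∀ {n} → (Fin n → ℤp p) → Term n → ℤp p
  evalT ρ (var i) = ρ i
  evalT ρ (s ⊕ t) = _+ₚ_ p (evalT ρ s) (evalT ρ t)

  holdsA : ∀ {n} → (Fin n → ℤp p) → Atom n → Set
  holdsA ρ (s ≐ t) = _≈ₚ_ p (evalT ρ s) (evalT ρ t)
  holdsA ρ (lt t)  = vLt p e (evalT ρ t)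

  ⟦_⟧ : ∀ {k} → PP k → (Fin k → ℤp p) → Set
  ⟦ ppf m ψs ⟧ ρ = Σ (Fin m → ℤp p) λ w → All (holdsA (ρ ++ w)) ψs

  PPDefinable : ∀ k → ((Fin k → ℤp p) → Set) → Set
  PPDefinable k R = Σ (PP k) λ φ → ∀ ρ → R ρ ⇔ ⟦ φ ⟧ ρ

module _ (N : ℕ) .{{nzN : NonZero N}} where

  addMod : Fin N → Fin N → Fin N
  addMod a b = fromℕ< (m%n<n (toℕ a + toℕ b) N)

  neq0 : Fin N → Set
  neq0 a = ¬ (toℕ a ≡ 0)

-- The partial surjection I : ℤ_p^d ⇀ ℤ/p^eℤ is given by its domain Dom
-- and a function I whose values outside Dom are irrelevant.

module _ (p : ℕ) .{{nzp : NonZero p}} (e : ℕ) where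

  private
    instance
      pe-nz : NonZero (p ^ e)
      pe-nz = m^n≢0 p e

  record PPInterpretation : Set₁ where
    field
      d    : ℕ
      Dom  : (Fin d → ℤp p) → Set
      I    : (Fin d → ℤp p) → Fin (p ^ e)
      surj : ∀ a → ∃ λ x → Dom x × I x ≡ a
      dom-pp : PPDefinable p e d Dom
      eq-pp  : Σ (PP (d + d)) λ φ → ∀ x y →
                 (Dom x × Dom y × I x ≡ I y) ⇔ ⟦_⟧ p e φ (x ++ y)
      neq0-pp : PPDefinable p e d (λ x → Dom x × neq0 (p ^ e) (I x))
      add-pp : Σ (PP (d + (d + d))) λ φ → ∀ x y z →
                 (Dom x × Dom y × Dom z × addMod (p ^ e) (I x) (I y) ≡ I z)
                   ⇔ ⟦_⟧ p e φ (x ++ (y ++ z))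

{-# OPTIONS --safe #-}
-- The interpretation is one-dimensional: a p-adic integer x stands for its
-- residue x mod pᵉ, so <ᵖₑ is literally the preimage of ≠₀.  The signature
-- has no subtraction, but congruence modulo pᵉ is still primitive positive:
-- a ≡ b (mod pᵉ) iff a = w + pᵉu and b = w + pᵉv for some w, u, v (take for w
-- the common residue and for u, v the pᵉ-quotients), and pᵉu is the term
-- u + ⋯ + u.  The graph of + is then congruence of x + y with z.
module Submission where

open import Defs
open import Data.Nat using (ℕ; zero; suc; _+_; _*_; _^_; _<_; NonZero; pred)
open import Data.Nat.Primality using (Prime; prime⇒nonZero)
open import Data.Nat.Properties
  using (m^n≢0; +-comm; +-identityʳ; *-comm; ^-distribˡ-+-*; suc-pred; m*n≢0)
open import Data.Nat.DivMod
open import Data.Nat.Divisibility using (_∣_; divides; n∣m*n; m∣m*n)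
open import Data.Fin using (Fin; zero; suc; toℕ; fromℕ<; _↑ˡ_; _↑ʳ_)
open import Data.Fin.Properties using (toℕ-fromℕ<; toℕ-injective; toℕ<n)
open import Data.List using ([]; _∷_)
open import Data.List.Relation.Unary.All using ([]; _∷_)
open import Data.Product using (∃-syntax; _×_; _,_)
open import Data.Unit using (⊤; tt)
open import Data.Vec.Functional using (_++_)
open import Data.Vec.Functional.Properties using (lookup-++ˡ; lookup-++ʳ)
open import Function.Bundles using (_⇔_; mk⇔; Equivalence)
open import Function.Properties.Equivalence using () renaming (trans to ⇔-trans; sym to ⇔-sym)
open import Relation.Binary.PropositionalEquality

[m+n%d]%d≡[m+n]%d : ∀ m n d .{{_ : NonZero d}} → (m + n % d) % d ≡ (m + n) % d
[m+n%d]%d≡[m+n]%d m n d = begin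
  (m + n % d) % d          ≡⟨ %-distribˡ-+ m (n % d) d ⟩
  (m % d + n % d % d) % d  ≡⟨ cong (λ k → (m % d + k) % d) (m%n%n≡m%n n d) ⟩
  (m % d + n % d) % d      ≡⟨ %-distribˡ-+ m n d ⟨
  (m + n) % d              ∎
  where open ≡-Reasoning

[m%d+n]%d≡[m+n]%d : ∀ m n d .{{_ : NonZero d}} → (m % d + n) % d ≡ (m + n) % d
[m%d+n]%d≡[m+n]%d m n d rewrite +-comm (m % d) n | +-comm m n = [m+n%d]%d≡[m+n]%d n m d

toℕ-≡⇔ : ∀ {N m n} {a b : Fin N} → toℕ a ≡ m → toℕ b ≡ n → (a ≡ b ⇔ m ≡ n)
toℕ-≡⇔ refl refl = mk⇔ (cong toℕ) toℕ-injective

⊤×⇔ : ∀ {A B : Set} → A ⇔ B → (⊤ × A) ⇔ B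
⊤×⇔ A⇔B = mk⇔ (λ (_ , a) → Equivalence.to A⇔B a) (λ b → tt , Equivalence.from A⇔B b)

rename : ∀ {m n} → (Fin m → Fin n) → Term m → Term n
rename f (var i) = var (f i)
rename f (s ⊕ t) = rename f s ⊕ rename f t

-- [1+ k ]· t denotes (1 + k) t: the signature has no constant 0.
infix 25 [1+_]·_
[1+_]·_ : ∀ {n} → ℕ → Term n → Term n
[1+ zero  ]· t = t
[1+ suc k ]· t = t ⊕ [1+ k ]· t

module _ (p : ℕ) .{{_ : NonZero p}} where

  res-mod : ∀ (x : ℤp p) n → modp p n (res x n) ≡ res x n
  res-mod x n = m<n⇒m%n≡m {{m^n≢0 p n}} (res< x n)

  res-mod-+ : ∀ (x : ℤp p) k m → modp p m (res x (k + m)) ≡ res x m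
  res-mod-+ x zero    m = res-mod x m
  res-mod-+ x (suc k) m = begin
    modp p m (res x (suc (k + m)))
      ≡⟨ m∣n⇒o%n%m≡o%m (p ^ m) (p ^ (k + m)) _ p^m∣p^[k+m] ⟨
    modp p m (modp p (k + m) (res x (suc (k + m))))
      ≡⟨ cong (modp p m) (coh x (k + m)) ⟩
    modp p m (res x (k + m))
      ≡⟨ res-mod-+ x k m ⟩
    res x m
      ∎
    where
      open ≡-Reasoning
      instance
        p^m≢0 : NonZero (p ^ m)
        p^m≢0 = m^n≢0 p m
        p^[k+m]≢0 : NonZero (p ^ (k + m))
        p^[k+m]≢0 = m^n≢0 p (k + m)
      p^m∣p^[k+m] : p ^ m ∣ p ^ (k + m)
      p^m∣p^[k+m] = divides (p ^ k) (^-distribˡ-+-* p k m)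

  fromℕₚ : ℕ → ℤp p
  res  (fromℕₚ r) n = modp p n r
  res< (fromℕₚ r) n = m%n<n r (p ^ n) {{m^n≢0 p n}}
  coh  (fromℕₚ r) n =
    m∣n⇒o%n%m≡o%m (p ^ n) (p ^ suc n) r {{m^n≢0 p n}} {{m^n≢0 p (suc n)}} (n∣m*n p)

  res-fromℕₚ : ∀ {r n} → r < p ^ n → res (fromℕₚ r) n ≡ r
  res-fromℕₚ {n = n} = m<n⇒m%n≡m {{m^n≢0 p n}}

  infix 4 _≈_+p^_·_
  _≈_+p^_·_ : ℤp p → ℤp p → ℕ → ℤp p → Set
  x ≈ w +p^ e · u = ∀ n → res x n ≡ modp p n (res w n + p ^ e * res u n)

  module _ (e : ℕ) where

    private
      instance
        p^e≢0 : NonZero (p ^ e)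
        p^e≢0 = m^n≢0 p e

    -- The digits of x from position e on, i.e. (x - (x mod pᵉ)) / pᵉ.
    quotient : ℤp p → ℤp p
    res  (quotient x) n = res x (n + e) / p ^ e
    res< (quotient x) n =
      m<n*o⇒m/o<n (subst (res x (n + e) <_) (^-distribˡ-+-* p n e) (res< x (n + e)))
    coh  (quotient x) n = begin
      X / p ^ e % p ^ n                             ≡⟨ m%[n*o]/o≡m/o%n X (p ^ n) (p ^ e) ⟨
      X % (p ^ n * p ^ e) / p ^ e                   ≡⟨ cong (_/ p ^ e) (%-congʳ p^[n+e]≡) ⟨
      modp p (n + e) (res x (suc (n + e))) / p ^ e  ≡⟨ cong (_/ p ^ e) (coh x (n + e)) ⟩
      res x (n + e) / p ^ e                         ∎
      where
        open ≡-Reasoning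
        X : ℕ
        X = res x (suc n + e)
        p^[n+e]≡ : p ^ (n + e) ≡ p ^ n * p ^ e
        p^[n+e]≡ = ^-distribˡ-+-* p n e
        instance
          p^n≢0 : NonZero (p ^ n)
          p^n≢0 = m^n≢0 p n
          p^[n+e]≢0 : NonZero (p ^ (n + e))
          p^[n+e]≢0 = m^n≢0 p (n + e)
          p^n*p^e≢0 : NonZero (p ^ n * p ^ e)
          p^n*p^e≢0 = m*n≢0 (p ^ n) (p ^ e)

    res-+p^· : ∀ {x w u} → x ≈ w +p^ e · u → res x e ≡ res w e
    res-+p^· {x} {w} {u} x≈ = begin
      res x e                               ≡⟨ x≈ e ⟩
      modp p e (res w e + p ^ e * res u e)  ≡⟨ %-remove-+ʳ (res w e) (m∣m*n {p ^ e} (res u e)) ⟩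
      modp p e (res w e)                    ≡⟨ res-mod w e ⟩
      res w e                               ∎
      where open ≡-Reasoning

    ≈-residue+p^·quotient : ∀ x → x ≈ fromℕₚ (res x e) +p^ e · quotient x
    ≈-residue+p^·quotient x n = sym (begin
      modp p n (modp p n (res x e) + p ^ e * (X / p ^ e))
        ≡⟨ [m%d+n]%d≡[m+n]%d (res x e) _ (p ^ n) ⟩
      modp p n (res x e + p ^ e * (X / p ^ e))
        ≡⟨ cong (λ r → modp p n (r + p ^ e * (X / p ^ e))) (res-mod-+ x n e) ⟨
      modp p n (X % p ^ e + p ^ e * (X / p ^ e))
        ≡⟨ cong (λ q → modp p n (X % p ^ e + q)) (*-comm (p ^ e) (X / p ^ e)) ⟩
      modp p n (X % p ^ e + X / p ^ e * p ^ e)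
        ≡⟨ cong (modp p n) (m≡m%n+[m/n]*n X (p ^ e)) ⟨
      modp p n X
        ≡⟨ cong (λ k → modp p n (res x k)) (+-comm n e) ⟩
      modp p n (res x (e + n))
        ≡⟨ res-mod-+ x e n ⟩
      res x n
        ∎)
      where
        open ≡-Reasoning
        X : ℕ
        X = res x (n + e)
        instance
          p^n≢0 : NonZero (p ^ n)
          p^n≢0 = m^n≢0 p n

    PPCongruent : ℤp p → ℤp p → Set
    PPCongruent a b = ∃[ w ] ∃[ u ] ∃[ v ] (a ≈ w +p^ e · u × b ≈ w +p^ e · v)

    res≡⇔PPCongruent : ∀ a b → res a e ≡ res b e ⇔ PPCongruent a b
    res≡⇔PPCongruent a b = mk⇔ common uncommon
      where
        common : res a e ≡ res b e → PPCongruent a b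
        common eq = fromℕₚ (res a e) , quotient a , quotient b ,
          ≈-residue+p^·quotient a ,
          subst (λ r → b ≈ fromℕₚ r +p^ e · quotient b) (sym eq) (≈-residue+p^·quotient b)
        uncommon : PPCongruent a b → res a e ≡ res b e
        uncommon (w , u , v , a≈ , b≈) =
          trans (res-+p^· {a} {w} {u} a≈) (sym (res-+p^· {b} {w} {v} b≈))

    infix 25 p^e·_
    p^e·_ : ∀ {n} → Term n → Term n
    p^e· t = [1+ pred (p ^ e) ]· t

    evalT-rename : ∀ {m n} {f : Fin m → Fin n} {σ ρ} →
                   (∀ i → σ (f i) ≡ ρ i) → ∀ t → evalT p e σ (rename f t) ≡ evalT p e ρ t
    evalT-rename σf≡ρ (var i) = σf≡ρ i
    evalT-rename σf≡ρ (s ⊕ t) = cong₂ (_+ₚ_ p) (evalT-rename σf≡ρ s) (evalT-rename σf≡ρ t)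

    res-[1+]· : ∀ {m} (ρ : Fin m → ℤp p) k t n →
                res (evalT p e ρ ([1+ k ]· t)) n ≡ modp p n (suc k * res (evalT p e ρ t) n)
    res-[1+]· ρ zero    t n =
      trans (sym (res-mod (evalT p e ρ t) n)) (cong (modp p n) (sym (+-identityʳ _)))
    res-[1+]· ρ (suc k) t n =
      trans (cong (λ r → modp p n (res x n + r)) (res-[1+]· ρ k t n))
            ([m+n%d]%d≡[m+n]%d (res x n) _ (p ^ n) {{m^n≢0 p n}})
      where
        x : ℤp p
        x = evalT p e ρ t

    holdsA-+p^e·⇔ : ∀ {m} {ρ : Fin m → ℤp p} s w u {x y z} →
                    evalT p e ρ s ≡ x → evalT p e ρ w ≡ y → evalT p e ρ u ≡ z →
                    holdsA p e ρ (s ≐ (w ⊕ p^e· u)) ⇔ x ≈ y +p^ e · z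
    holdsA-+p^e·⇔ {ρ = ρ} s w u {y = y} {z} refl refl refl =
      mk⇔ (λ h n → trans (h n) (eq n)) (λ h n → trans (h n) (sym (eq n)))
      where
        eq : ∀ n → modp p n (res y n + res (evalT p e ρ (p^e· u)) n)
                 ≡ modp p n (res y n + p ^ e * res z n)
        eq n = begin
          modp p n (res y n + res (evalT p e ρ (p^e· u)) n)
            ≡⟨ cong (λ r → modp p n (res y n + r)) (res-[1+]· ρ (pred (p ^ e)) u n) ⟩
          modp p n (res y n + modp p n (suc (pred (p ^ e)) * res z n))
            ≡⟨ [m+n%d]%d≡[m+n]%d (res y n) _ (p ^ n) {{m^n≢0 p n}} ⟩
          modp p n (res y n + suc (pred (p ^ e)) * res z n)
            ≡⟨ cong (λ q → modp p n (res y n + q * res z n)) (suc-pred (p ^ e)) ⟩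
          modp p n (res y n + p ^ e * res z n)
            ∎
          where open ≡-Reasoning

    congruentPP : ∀ {k} → Term k → Term k → PP k
    congruentPP {k} s t = ppf 3
      ( (rename (_↑ˡ 3) s ≐ (∃var zero ⊕ p^e· ∃var (suc zero)))
      ∷ (rename (_↑ˡ 3) t ≐ (∃var zero ⊕ p^e· ∃var (suc (suc zero))))
      ∷ [])
      where
        ∃var : Fin 3 → Term (k + 3)
        ∃var i = var (k ↑ʳ i)

    ⟦congruentPP⟧⇔ : ∀ {k} (s t : Term k) ρ →
                     ⟦_⟧ p e (congruentPP s t) ρ ⇔ res (evalT p e ρ s) e ≡ res (evalT p e ρ t) e
    ⟦congruentPP⟧⇔ {k} s t ρ = ⇔-trans (mk⇔ to from) (⇔-sym (res≡⇔PPCongruent S T))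
      where
        S T : ℤp p
        S = evalT p e ρ s
        T = evalT p e ρ t
        holds⇔ : ∀ r (ws : Fin 3 → ℤp p) i j →
                 holdsA p e (ρ ++ ws) (rename (_↑ˡ 3) r ≐ (var (k ↑ʳ i) ⊕ p^e· var (k ↑ʳ j)))
                   ⇔ evalT p e ρ r ≈ ws i +p^ e · ws j
        holds⇔ r ws i j =
          holdsA-+p^e·⇔ (rename (_↑ˡ 3) r) (var (k ↑ʳ i)) (var (k ↑ʳ j))
                        (evalT-rename {f = _↑ˡ 3} {σ = ρ ++ ws} (lookup-++ˡ ρ ws) r)
                        (lookup-++ʳ ρ ws i) (lookup-++ʳ ρ ws j)
        to : ⟦_⟧ p e (congruentPP s t) ρ → PPCongruent S T
        to (ws , hs ∷ ht ∷ []) =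
          ws zero , ws (suc zero) , ws (suc (suc zero)) ,
          Equivalence.to (holds⇔ s ws zero (suc zero)) hs ,
          Equivalence.to (holds⇔ t ws zero (suc (suc zero))) ht
        from : PPCongruent S T → ⟦_⟧ p e (congruentPP s t) ρ
        from (w , u , v , s≈ , t≈) =
          ws , Equivalence.from (holds⇔ s ws zero (suc zero)) s≈
             ∷ Equivalence.from (holds⇔ t ws zero (suc (suc zero))) t≈ ∷ []
          where
            ws : Fin 3 → ℤp p
            ws zero = w
            ws (suc zero) = u
            ws (suc (suc zero)) = v

    residue : (Fin 1 → ℤp p) → Fin (p ^ e)
    residue x = fromℕ< (res< (x zero) e)

    toℕ-residue : ∀ x → toℕ (residue x) ≡ res (x zero) e
    toℕ-residue x = toℕ-fromℕ< (res< (x zero) e)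

    residue-fromℕₚ : ∀ a → residue (λ _ → fromℕₚ (toℕ a)) ≡ a
    residue-fromℕₚ a =
      toℕ-injective (trans (toℕ-residue (λ _ → fromℕₚ (toℕ a))) (res-fromℕₚ {n = e} (toℕ<n a)))

    neq0-residue⇔vLt : ∀ x → neq0 (p ^ e) (residue x) ⇔ vLt p e (x zero)
    neq0-residue⇔vLt x = mk⇔ (λ r≢0 r≡0 → r≢0 (trans (toℕ-residue x) r≡0))
                              (λ r≢0 r≡0 → r≢0 (trans (sym (toℕ-residue x)) r≡0))

    toℕ-addMod-residue : ∀ x y →
      toℕ (addMod (p ^ e) (residue x) (residue y)) ≡ res (_+ₚ_ p (x zero) (y zero)) e
    toℕ-addMod-residue x y =
      trans (toℕ-fromℕ< (m%n<n (toℕ (residue x) + toℕ (residue y)) (p ^ e)))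
            (cong₂ (λ a b → modp p e (a + b)) (toℕ-residue x) (toℕ-residue y))

    residueInterpretation : PPInterpretation p e
    residueInterpretation = record
      { d       = 1
      ; Dom     = λ _ → ⊤
      ; I       = residue
      ; surj    = λ a → (λ _ → fromℕₚ (toℕ a)) , tt , residue-fromℕₚ a
      ; dom-pp  = ppf 0 [] , λ _ → mk⇔ (λ _ → (λ ()) , []) (λ _ → tt)
      ; eq-pp   = congruentPP (var zero) (var (suc zero)) , λ x y →
                    ⊤×⇔ (⊤×⇔ (⇔-trans (toℕ-≡⇔ (toℕ-residue x) (toℕ-residue y))
                                      (⇔-sym (⟦congruentPP⟧⇔ _ _ (x ++ y)))))
      ; neq0-pp = ppf 0 (lt (var zero) ∷ []) , λ x →
                    ⊤×⇔ (⇔-trans (neq0-residue⇔vLt x)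
                                 (mk⇔ (λ x<ₑ → (λ ()) , x<ₑ ∷ []) λ { (_ , x<ₑ ∷ []) → x<ₑ }))
      ; add-pp  = congruentPP (var zero ⊕ var (suc zero)) (var (suc (suc zero))) ,
                  λ x y z →
                    ⊤×⇔ (⊤×⇔ (⊤×⇔ (⇔-trans
                      (toℕ-≡⇔ (toℕ-addMod-residue x y) (toℕ-residue z))
                      (⇔-sym (⟦congruentPP⟧⇔ _ _ (x ++ (y ++ z)))))))
      }

lemma5p2 : (p : ℕ) (pr : Prime p) (e : ℕ) →
    PPInterpretation p {{prime⇒nonZero pr}} e
lemma5p2 p pr e = residueInterpretation p {{prime⇒nonZero pr}} e
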